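{- Let $a_1,\dots,a_n$ be positive integers with $\gcd(a_1,\dots,a_n)=1$, $m=\sum_ia_i$, $k=\lceil\log m\rceil$, let $K\ge2k$ be an integer, $c_K=\lfloor2^K/m\rfloor$, and for an index $i$ let $p_i=a_i/m$ and $q_i=c_Ka_i/2^K$. Assume $m$ is not a power of two and $p_i$ is not a power of two. Then $p_i$ and $q_i$ have the same most significant bit, i.e., $\lfloor\log p_i\rfloor=\lfloor\log q_i\rfloor$.
   Context: All logarithms are base 2. -}

module Defs where

open import Data.Nat as ℕ using (ℕ; zero; suc; _^_)
open import Data.Nat.GCD using (gcd)
open import Data.Nat.DivMod using (_/_)
open import Data.Integer as ℤ using (ℤ; +_; -[1+_])
open import Data.Rational as ℚ using (ℚ; 0ℚ; 1ℚ; ½; _*_; _≤_; _<_)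
open import Data.Vec using (Vec; foldr′)
open import Data.Product using (_×_)

gcdVec : ∀ {n} → Vec ℕ n → ℕ
gcdVec = foldr′ gcd 0

-- the rational number a / b  (b = 0 is never used; mapped to 0 for totality)
frac : ℕ → ℕ → ℚ
frac a zero    = 0ℚ
frac a (suc b) = ℚ._/_ (+ a) (suc b)

-- natural-number floor division (divisor 0 never used; mapped to 0 for totality)
divℕ : ℕ → ℕ → ℕ
divℕ x zero    = 0
divℕ x (suc d) = x / suc d

twoPow : ℕ → ℚ
twoPow zero    = 1ℚ
twoPow (suc j) = ℚ._/_ (+ 2) 1 * twoPow j

halfPow : ℕ → ℚ
halfPow zero    = 1ℚ
halfPow (suc j) = ½ * halfPow j

pow2 : ℤ → ℚ
pow2 (+ j)     = twoPow j
pow2 -[1+ j ]  = halfPow (suc j)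

IsFloorLog2 : ℚ → ℤ → Set
IsFloorLog2 x e = (pow2 e ≤ x) × (x < pow2 (e ℤ.+ + 1))

-- Write x/m with 0 < x < m.  Since x/m is not a power of two, there is a unique t with
-- x·2^t < m < x·2^(t+1), i.e. ⌊log₂ (x/m)⌋ = -(t+1).  Put P = 2^K ≥ m² and c = ⌊P/m⌋, so that
-- c·m ≤ P < c·(m+1) (the remainder is below m ≤ c).  Multiplying the bracket by c gives
-- c·x·2^t < c·m ≤ P < c·(m+1) ≤ c·x·2^(t+1), so c·x/P lies in the same binade as x/m.
module Submission where

open import Defs
open import Data.Nat using (ℕ; _<_; _≤_; _*_; _^_)
open import Data.Nat.Logarithm using (⌈log₂_⌉)
open import Data.Integer using (ℤ)
open import Data.Fin using (Fin)
open import Data.Vec using (Vec; lookup; sum)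
open import Data.Product using (∃; _×_)
open import Relation.Nullary using (¬_)
open import Relation.Binary.PropositionalEquality using (_≡_)

open import Data.Nat using (zero; suc; pred; _+_; _∸_; z≤n; s≤s; z<s; ⌈_/2⌉; _<?_; NonZero; >-nonZero)
open import Data.Nat.Properties
open import Data.Nat.DivMod using (_/_; _%_; m≡m%n+[m/n]*n; m%n<n; m/n*n≤m; m*n/n≡m; /-monoˡ-≤)
open import Data.Nat.Logarithm using (⌈log₂⌉-mono-≤; ⌈log₂⌈n/2⌉⌉≡⌈log₂n⌉∸1)
open import Data.Integer as ℤ using (+_; -[1+_]; +≤+; +<+)
open import Data.Integer.Properties as ℤₚ using (pos-*)
open import Data.Rational as ℚ using (½; toℚᵘ)
open import Data.Rational.Properties using (toℚᵘ-fromℚᵘ; toℚᵘ-homo-*; toℚᵘ-cancel-≤; toℚᵘ-cancel-<; toℚᵘ-injective)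
open import Data.Rational.Unnormalised as ℚᵘ using (mkℚᵘ; *≡*; *≤*; *<*)
open import Data.Rational.Unnormalised.Properties as ℚᵘₚ
  using (≃-refl; ≃-sym; ≃-trans; ≤-respˡ-≃; ≤-respʳ-≃; <-respˡ-≃; <-respʳ-≃)
open import Data.Product using (_,_; proj₁; proj₂; ∃-syntax)
open import Data.Vec using (_∷_)
open import Relation.Nullary using (yes; no; contradiction)
open import Relation.Binary.PropositionalEquality using (refl; sym; trans; cong; subst; subst₂; _≢_)

suc-pred-2^ : ∀ s → suc (pred (2 ^ s)) ≡ 2 ^ s
suc-pred-2^ s = suc-pred (2 ^ s) {{m^n≢0 2 s}}

2^k+2^k≡2^[1+k] : ∀ k → 2 ^ k + 2 ^ k ≡ 2 ^ suc k
2^k+2^k≡2^[1+k] k = cong (λ w → 2 ^ k + w) (sym (+-identityʳ (2 ^ k)))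

n≤⌈n/2⌉+⌈n/2⌉ : ∀ n → n ≤ ⌈ n /2⌉ + ⌈ n /2⌉
n≤⌈n/2⌉+⌈n/2⌉ n = subst (_≤ ⌈ n /2⌉ + ⌈ n /2⌉) (⌊n/2⌋+⌈n/2⌉≡n n)
  (+-monoˡ-≤ ⌈ n /2⌉ (⌊n/2⌋≤⌈n/2⌉ n))

n≤2^⌈log₂n⌉ : ∀ n → n ≤ 2 ^ ⌈log₂ n ⌉
n≤2^⌈log₂n⌉ n = bound ⌈log₂ n ⌉ n refl
  where
  bound : ∀ k n → ⌈log₂ n ⌉ ≡ k → n ≤ 2 ^ k
  bound k zero          _  = z≤n
  bound k (suc zero)    _  = m^n>0 2 k
  bound zero n@(suc (suc _)) eq =
    contradiction (subst (1 ≤_) eq (⌈log₂⌉-mono-≤ {2} {n} (s≤s (s≤s z≤n)))) λ ()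
  bound (suc k) n@(suc (suc _)) eq = begin
    n                     ≤⟨ n≤⌈n/2⌉+⌈n/2⌉ n ⟩
    ⌈ n /2⌉ + ⌈ n /2⌉     ≤⟨ +-mono-≤ half half ⟩
    2 ^ k + 2 ^ k         ≡⟨ 2^k+2^k≡2^[1+k] k ⟩
    2 ^ suc k             ∎
    where
    open ≤-Reasoning
    half : ⌈ n /2⌉ ≤ 2 ^ k
    half = bound k ⌈ n /2⌉ (trans (⌈log₂⌈n/2⌉⌉≡⌈log₂n⌉∸1 n) (cong (_∸ 1) eq))

n*n≤2^K : ∀ n K → 2 * ⌈log₂ n ⌉ ≤ K → n * n ≤ 2 ^ K
n*n≤2^K n K hK = begin
  n * n                  ≤⟨ *-mono-≤ n≤2^L n≤2^L ⟩
  2 ^ L * 2 ^ L          ≡⟨ sym (^-distribˡ-+-* 2 L L) ⟩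
  2 ^ (L + L)            ≡⟨ cong (λ w → 2 ^ (L + w)) (sym (+-identityʳ L)) ⟩
  2 ^ (2 * L)            ≤⟨ ^-monoʳ-≤ 2 hK ⟩
  2 ^ K                  ∎
  where
  open ≤-Reasoning
  L : ℕ
  L = ⌈log₂ n ⌉
  n≤2^L : n ≤ 2 ^ L
  n≤2^L = n≤2^⌈log₂n⌉ n

∃x*2^t<m<x*2^[1+t] : ∀ N {x m} → x < m → m ≤ x * 2 ^ N → (∀ t → x * 2 ^ t ≢ m) →
                      ∃[ t ] x * 2 ^ t < m × m < x * 2 ^ suc t
∃x*2^t<m<x*2^[1+t] zero {x} x<m m≤x*1 _ =
  contradiction (subst (_ ≤_) (*-identityʳ x) m≤x*1) (<⇒≱ x<m)
∃x*2^t<m<x*2^[1+t] (suc N) {x} {m} x<m m≤x2^[1+N] ≢m with x * 2 ^ N <? m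
... | yes below = N , below , ≤∧≢⇒< m≤x2^[1+N] (λ eq → ≢m (suc N) (sym eq))
... | no  above = ∃x*2^t<m<x*2^[1+t] N x<m (≮⇒≥ above) ≢m

n≤m/n : ∀ {m} n .{{_ : NonZero n}} → n * n ≤ m → n ≤ m / n
n≤m/n {m} n n*n≤m = subst (_≤ m / n) (m*n/n≡m n n) (/-monoˡ-≤ n n*n≤m)

m<[m/n]*[1+n] : ∀ m n .{{_ : NonZero n}} → n ≤ m / n → m < (m / n) * suc n
m<[m/n]*[1+n] m n n≤m/n = begin-strict
  m                      ≡⟨ m≡m%n+[m/n]*n m n ⟩
  m % n + (m / n) * n    <⟨ +-monoˡ-< ((m / n) * n) (<-≤-trans (m%n<n m n) n≤m/n) ⟩
  m / n + (m / n) * n    ≡⟨ sym (*-suc (m / n) n) ⟩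
  (m / n) * suc n        ∎
  where open ≤-Reasoning

scaled-bracket : ∀ {x m c P} t .{{_ : NonZero c}} →
                 x * 2 ^ t < m → m < x * 2 ^ suc t → c * m ≤ P → P < c * suc m →
                 c * x * 2 ^ t < P × P ≤ c * x * 2 ^ suc t
scaled-bracket {x} {m} {c} {P} t lo hi cm≤P P<c[1+m] = lower , upper
  where
  open ≤-Reasoning
  lower : c * x * 2 ^ t < P
  lower = begin-strict
    c * x * 2 ^ t        ≡⟨ *-assoc c x (2 ^ t) ⟩
    c * (x * 2 ^ t)      <⟨ *-monoʳ-< c lo ⟩
    c * m                ≤⟨ cm≤P ⟩
    P                    ∎
  upper : P ≤ c * x * 2 ^ suc t
  upper = begin
    P                    ≤⟨ <⇒≤ P<c[1+m] ⟩
    c * suc m            ≤⟨ *-monoʳ-≤ c hi ⟩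
    c * (x * 2 ^ suc t)  ≡⟨ sym (*-assoc c x (2 ^ suc t)) ⟩
    c * x * 2 ^ suc t    ∎

toℚᵘ-frac : ∀ a b → toℚᵘ (frac a (suc b)) ℚᵘ.≃ mkℚᵘ (+ a) b
toℚᵘ-frac a b = toℚᵘ-fromℚᵘ (mkℚᵘ (+ a) b)

toℚᵘ-halfPow : ∀ s → toℚᵘ (halfPow s) ℚᵘ.≃ mkℚᵘ (+ 1) (pred (2 ^ s))
toℚᵘ-halfPow zero    = ≃-refl
toℚᵘ-halfPow (suc s) =
  ≃-trans (toℚᵘ-homo-* ½ (halfPow s))
    (≃-trans (ℚᵘₚ.*-congˡ {mkℚᵘ (+ 1) 1} (toℚᵘ-halfPow s))
      (*≡* (cong (λ d → + 1 ℤ.* + d) (trans (suc-pred-2^ (suc s))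
                                             (cong (2 *_) (sym (suc-pred-2^ s)))))))

+a*[2^s]≡+[a*2^s] : ∀ a s → + a ℤ.* + suc (pred (2 ^ s)) ≡ + (a * 2 ^ s)
+a*[2^s]≡+[a*2^s] a s = trans (sym (pos-* a _)) (cong (λ d → + (a * d)) (suc-pred-2^ s))

halfPow≤frac : ∀ s a b → suc b ≤ a * 2 ^ s → halfPow s ℚ.≤ frac a (suc b)
halfPow≤frac s a b le = toℚᵘ-cancel-≤
  (≤-respˡ-≃ (≃-sym (toℚᵘ-halfPow s)) (≤-respʳ-≃ (≃-sym (toℚᵘ-frac a b))
    (*≤* (subst₂ ℤ._≤_ (sym (ℤₚ.*-identityˡ _)) (sym (+a*[2^s]≡+[a*2^s] a s)) (+≤+ le)))))

frac<halfPow : ∀ s a b → a * 2 ^ s < suc b → frac a (suc b) ℚ.< halfPow s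
frac<halfPow s a b lt = toℚᵘ-cancel-<
  (<-respʳ-≃ (≃-sym (toℚᵘ-halfPow s)) (<-respˡ-≃ (≃-sym (toℚᵘ-frac a b))
    (*<* (subst₂ ℤ._<_ (sym (+a*[2^s]≡+[a*2^s] a s)) (sym (ℤₚ.*-identityˡ _)) (+<+ lt)))))

frac≡halfPow : ∀ s a b → a * 2 ^ s ≡ suc b → frac a (suc b) ≡ halfPow s
frac≡halfPow s a b eq = toℚᵘ-injective
  (≃-trans (toℚᵘ-frac a b) (≃-trans
    (*≡* (trans (+a*[2^s]≡+[a*2^s] a s) (trans (cong +_ eq) (sym (ℤₚ.*-identityˡ _)))))
    (≃-sym (toℚᵘ-halfPow s))))

pow2-neg : ∀ t → pow2 (ℤ.- + t) ≡ halfPow t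
pow2-neg zero    = refl
pow2-neg (suc t) = refl

pow2-[1+t]+1 : ∀ t → pow2 (-[1+ t ] ℤ.+ + 1) ≡ halfPow t
pow2-[1+t]+1 zero    = refl
pow2-[1+t]+1 (suc t) = refl

isFloorLog2-frac : ∀ t a b → a * 2 ^ t < suc b → suc b ≤ a * 2 ^ suc t →
                   IsFloorLog2 (frac a (suc b)) -[1+ t ]
isFloorLog2-frac t a b lo hi =
  halfPow≤frac (suc t) a b hi , subst (_ ℚ.<_) (sym (pow2-[1+t]+1 t)) (frac<halfPow t a b lo)

floorLog2-frac-scaled : ∀ x m P → 0 < x → x ≤ m → m * m ≤ P →
    ¬ (∃ λ (e : ℤ) → frac x m ≡ pow2 e) →
    ∃ λ (e : ℤ) → IsFloorLog2 (frac x m) e × IsFloorLog2 (frac (divℕ P m * x) P) e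
floorLog2-frac-scaled x zero P 0<x x≤0 _ _ = contradiction (<-≤-trans 0<x x≤0) λ ()
floorLog2-frac-scaled x m@(suc y) zero _ _ () _
floorLog2-frac-scaled x m@(suc y) P@(suc z) 0<x x≤m m*m≤P not-pow2 =
  -[1+ t ] , isFloorLog2-frac t x y lo (<⇒≤ hi)
           , isFloorLog2-frac t (c * x) z c*x*2^t<P P≤c*x*2^[1+t]
  where
  c : ℕ
  c = P / m
  m≤c : m ≤ c
  m≤c = n≤m/n m m*m≤P
  instance
    c≢0 : NonZero c
    c≢0 = >-nonZero (<-≤-trans z<s m≤c)
  ≢m : ∀ t → x * 2 ^ t ≢ m
  ≢m t eq = not-pow2 (ℤ.- + t , trans (frac≡halfPow t x y eq) (sym (pow2-neg t)))
  x<m : x < m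
  x<m = ≤∧≢⇒< x≤m (λ eq → ≢m 0 (trans (*-identityʳ x) eq))
  m≤x*2^L : m ≤ x * 2 ^ ⌈log₂ m ⌉
  m≤x*2^L = ≤-trans (n≤2^⌈log₂n⌉ m) (m≤n*m (2 ^ ⌈log₂ m ⌉) x {{>-nonZero 0<x}})
  bracket : ∃[ t ] x * 2 ^ t < m × m < x * 2 ^ suc t
  bracket = ∃x*2^t<m<x*2^[1+t] ⌈log₂ m ⌉ x<m m≤x*2^L ≢m
  t : ℕ
  t = proj₁ bracket
  lo : x * 2 ^ t < m
  lo = proj₁ (proj₂ bracket)
  hi : m < x * 2 ^ suc t
  hi = proj₂ (proj₂ bracket)
  scaled : c * x * 2 ^ t < P × P ≤ c * x * 2 ^ suc t
  scaled = scaled-bracket t lo hi (m/n*n≤m P m) (m<[m/n]*[1+n] P m m≤c)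
  c*x*2^t<P : c * x * 2 ^ t < P
  c*x*2^t<P = proj₁ scaled
  P≤c*x*2^[1+t] : P ≤ c * x * 2 ^ suc t
  P≤c*x*2^[1+t] = proj₂ scaled

lookup≤sum : ∀ {n} (a : Vec ℕ n) i → lookup a i ≤ sum a
lookup≤sum (x ∷ a) Fin.zero    = m≤m+n x (sum a)
lookup≤sum (x ∷ a) (Fin.suc i) = ≤-trans (lookup≤sum a i) (m≤n+m (sum a) x)

lemma4p16 : (n : ℕ) (a : Vec ℕ n) →
    (∀ i → 0 < lookup a i) →
    gcdVec a ≡ 1 →
    (K : ℕ) → 2 * ⌈log₂ (sum a) ⌉ ≤ K →
    (i : Fin n) →
    ¬ (∃ λ (j : ℕ) → sum a ≡ 2 ^ j) →
    ¬ (∃ λ (e : ℤ) → frac (lookup a i) (sum a) ≡ pow2 e) →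
    ∃ λ (e : ℤ) →
      IsFloorLog2 (frac (lookup a i) (sum a)) e ×
      IsFloorLog2 (frac (divℕ (2 ^ K) (sum a) * lookup a i) (2 ^ K)) e
lemma4p16 n a positive _ K 2⌈log₂m⌉≤K i _ not-pow2 =
  floorLog2-frac-scaled (lookup a i) (sum a) (2 ^ K)
    (positive i) (lookup≤sum a i) (n*n≤2^K (sum a) K 2⌈log₂m⌉≤K) not-pow2
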